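{- For $|q|<1$ let $(a;q)_n=\prod_{k=0}^{n-1}(1-aq^k)$, $(a)_n=(a;q)_n$, and define $$L(q)=\sum_{n=1}^\infty\frac{q^n(q^2;q^2)_{n-1}}{(-q^2;q^2)_n},\qquad LL(q)=\sum_{n=1}^\infty\frac{(q)_{n-1}(-1)^nq^{n(n+1)/2}}{(-q)_n}.$$ Then $L(-q)=LL(q)$. -}

module Defs where

-- Formal power series over ℤ in the variable q, represented by their
-- coefficient functions: a series f stands for Σ_m f m q^m.

open import Data.Nat using (ℕ; zero; suc; _∸_; _≡ᵇ_)
open import Data.Integer using (ℤ; +_; -_; _+_; _*_; _-_; 0ℤ; 1ℤ)
open import Data.Bool using (if_then_else_)
open import Data.List using (List; []; _∷_)

Series : Set
Series = ℕ → ℤ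

sum0 : (ℕ → ℤ) → ℕ → ℤ
sum0 f zero    = f zero
sum0 f (suc m) = sum0 f m + f (suc m)

sum1 : (ℕ → ℤ) → ℕ → ℤ
sum1 f zero    = 0ℤ
sum1 f (suc m) = sum1 f m + f (suc m)

one : Series
one m = if m ≡ᵇ 0 then 1ℤ else 0ℤ

mono : ℤ → ℕ → Series
mono c j m = if m ≡ᵇ j then c else 0ℤ

_⊛_ : Series → Series → Series
(f ⊛ g) m = sum0 (λ i → f i * g (m ∸ i)) m

infixl 7 _⊛_

oneMinus : ℤ → ℕ → Series
oneMinus c j m = one m - mono c j m

-- (c q^e ; q^d)_n = Π_{k=0}^{n-1} (1 - c q^(e + d k))
poch : ℤ → ℕ → ℕ → ℕ → Series
poch c e d zero    = one
poch c e d (suc n) = poch c e d n ⊛ oneMinus c (e Data.Nat.+ d Data.Nat.* n)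

-- Multiplicative inverse of a series f with constant term 1:
-- g 0 = 1,  g m = - Σ_{i=1}^{m} f i * g (m - i).
-- invPrefix f m is the list [g m, g (m-1), …, g 0].
private
  dot : Series → ℕ → List ℤ → ℤ
  dot f k []       = 0ℤ
  dot f k (x ∷ xs) = f (suc k) * x + dot f (suc k) xs

invPrefix : Series → ℕ → List ℤ
invPrefix f zero    = 1ℤ ∷ []
invPrefix f (suc m) = let gs = invPrefix f m in (- dot f 0 gs) ∷ gs

inv : Series → Series
inv f m with invPrefix f m
... | []    = 0ℤ
... | x ∷ _ = x

sgn : ℕ → ℤ
sgn zero    = 1ℤ
sgn (suc m) = - sgn m

tri : ℕ → ℕ
tri zero    = 0
tri (suc n) = suc n Data.Nat.+ tri n

Lterm : ℕ → Series
Lterm n = mono 1ℤ n ⊛ poch 1ℤ 2 2 (n ∸ 1) ⊛ inv (poch (- 1ℤ) 2 2 n)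

LLterm : ℕ → Series
LLterm n = poch 1ℤ 1 1 (n ∸ 1) ⊛ mono (sgn n) (tri n) ⊛ inv (poch (- 1ℤ) 1 1 n)

-- L(q) = Σ_{n≥1} Lterm n.  Each summand has q-adic order ≥ n, so the
-- coefficient of q^m in the (formally convergent) sum is Σ_{n=1}^{m}.
L : Series
L m = sum1 (λ n → Lterm n m) m

LL : Series
LL m = sum1 (λ n → LLterm n m) m

negArg : Series → Series
negArg f m = sgn m * f m

-- For e ≥ 1 consider the two families
--   A_e = Σ_{n≥1} (-1)^n q^{en} (q²;q²)_{n-1} / (-q²;q²)_n,
--   B_e = - Σ_{j≥0} q^{(e+2j)(j+1)} (q²;q²)_j (q^e;q²)_j (1 + q^{e+4j+2}) / ((-q²;q²)_{j+1} (-q^e;q²)_{j+1}).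
-- A_1 is L(-q), and B_1 is LL(q) with its summands grouped in pairs.  For both families the
-- summands of (1 + q^e) F_e + (1 - q^e) F_{e+2} telescope to -q^e, and F_e is divisible by q^e.
-- Hence D_e = A_e - B_e satisfies (1 + q^e) D_e = -(1 - q^e) D_{e+2}; as 1 + q^e is a unit,
-- D_{e+2} ≡ 0 forces D_e ≡ 0 modulo q^N, and D_e ≡ 0 holds trivially once e ≥ N.
-- For partial sums of N terms the functional equation holds up to an error divisible by q^N,
-- which is all the argument needs.

module Submission where

open import Defs
open import Data.Nat as ℕ using (ℕ; zero; suc; _∸_; _≡ᵇ_; _≤_; _<_; z≤n; s≤s)
import Data.Nat.Properties as ℕP
import Data.Nat.Tactic.RingSolver as ℕSolver
open import Data.Integer as ℤ using (ℤ; -_; _+_; _*_; 0ℤ; 1ℤ)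
import Data.Integer.Properties as ℤP
open import Data.Integer.Tactic.RingSolver using (solve-∀)
open import Data.Bool using (true; false; if_then_else_; T)
open import Data.List using (List; []; _∷_)
open import Data.Maybe using (Maybe; just; nothing)
open import Data.Product using (_,_)
open import Data.Unit using (tt)
open import Data.Empty using (⊥-elim)
open import Function using (_∘_)
open import Relation.Nullary using (yes; no)
open import Relation.Binary.PropositionalEquality
open import Relation.Binary.Structures using (IsEquivalence)
open import Algebra.Bundles using (CommutativeRing; RawRing)
import Algebra.Solver.Ring.AlmostCommutativeRing as ACR
import Algebra.Solver.Ring
import Relation.Binary.Reasoning.Setoid as SetoidReasoning

infix  4 _≈_
infixl 6 _⊕_ _⊖_

_≈_ : Series → Series → Set
f ≈ g = ∀ m → f m ≡ g m

0ˢ : Series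
0ˢ _ = 0ℤ

_⊕_ : Series → Series → Series
(f ⊕ g) m = f m + g m

⊝_ : Series → Series
(⊝ f) m = - f m

_⊖_ : Series → Series → Series
f ⊖ g = f ⊕ ⊝ g

scale : ℤ → Series → Series
scale c f m = c * f m

tail : Series → Series
tail f i = f (suc i)

sum0-sucˡ : ∀ f m → sum0 f (suc m) ≡ f 0 + sum0 (f ∘ suc) m
sum0-sucˡ f zero    = refl
sum0-sucˡ f (suc m) rewrite sum0-sucˡ f m = ℤP.+-assoc (f 0) _ _

sum0-cong : ∀ {f g} m → (∀ i → i ≤ m → f i ≡ g i) → sum0 f m ≡ sum0 g m
sum0-cong zero    f≡g = f≡g 0 z≤n
sum0-cong (suc m) f≡g =
  cong₂ _+_ (sum0-cong m (λ i i≤m → f≡g i (ℕP.m≤n⇒m≤1+n i≤m))) (f≡g (suc m) ℕP.≤-refl)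

sum0-distrib-+ : ∀ f g m → sum0 (λ i → f i + g i) m ≡ sum0 f m + sum0 g m
sum0-distrib-+ f g zero    = refl
sum0-distrib-+ f g (suc m) rewrite sum0-distrib-+ f g m =
  interchange (sum0 f m) (sum0 g m) (f (suc m)) (g (suc m))
  where
  interchange : ∀ a b c d → a + b + (c + d) ≡ a + c + (b + d)
  interchange = solve-∀

sum0-*ˡ : ∀ c f m → sum0 (λ i → c * f i) m ≡ c * sum0 f m
sum0-*ˡ c f zero    = refl
sum0-*ˡ c f (suc m) rewrite sum0-*ˡ c f m = sym (ℤP.*-distribˡ-+ c (sum0 f m) (f (suc m)))

sum0-zero : ∀ m → sum0 (λ _ → 0ℤ) m ≡ 0ℤ
sum0-zero zero    = refl
sum0-zero (suc m) rewrite sum0-zero m = refl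

sum0-reverse : ∀ f m → sum0 f m ≡ sum0 (λ i → f (m ∸ i)) m
sum0-reverse f zero    = refl
sum0-reverse f (suc m) =
  trans (cong (_+ f (suc m)) (sum0-reverse f m))
        (trans (ℤP.+-comm _ (f (suc m))) (sym (sum0-sucˡ (λ i → f (suc m ∸ i)) m)))

⊛-suc : ∀ f g m → (f ⊛ g) (suc m) ≡ f 0 * g (suc m) + (tail f ⊛ g) m
⊛-suc f g m = sum0-sucˡ (λ i → f i * g (suc m ∸ i)) m

⊛-congˡ : ∀ {f f'} g → f ≈ f' → f ⊛ g ≈ f' ⊛ g
⊛-congˡ g f≈f' m = sum0-cong m (λ i _ → cong (_* g (m ∸ i)) (f≈f' i))

⊛-congʳ : ∀ f {g g'} → g ≈ g' → f ⊛ g ≈ f ⊛ g'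
⊛-congʳ f g≈g' m = sum0-cong m (λ i _ → cong (f i *_) (g≈g' (m ∸ i)))

⊛-distribˡ : ∀ f g h → f ⊛ (g ⊕ h) ≈ f ⊛ g ⊕ f ⊛ h
⊛-distribˡ f g h m =
  trans (sum0-cong m (λ i _ → ℤP.*-distribˡ-+ (f i) (g (m ∸ i)) (h (m ∸ i)))) (sum0-distrib-+ _ _ m)

⊛-distribʳ : ∀ f g h → (f ⊕ g) ⊛ h ≈ f ⊛ h ⊕ g ⊛ h
⊛-distribʳ f g h m =
  trans (sum0-cong m (λ i _ → ℤP.*-distribʳ-+ (h (m ∸ i)) (f i) (g i))) (sum0-distrib-+ _ _ m)

⊛-scaleˡ : ∀ c f g → scale c f ⊛ g ≈ scale c (f ⊛ g)
⊛-scaleˡ c f g m = trans (sum0-cong m (λ i _ → ℤP.*-assoc c (f i) (g (m ∸ i)))) (sum0-*ˡ c _ m)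

⊛-zeroˡ : ∀ g → 0ˢ ⊛ g ≈ 0ˢ
⊛-zeroˡ g m = trans (sum0-cong m (λ i _ → ℤP.*-zeroˡ (g (m ∸ i)))) (sum0-zero m)

tail-⊛ : ∀ f g → tail (f ⊛ g) ≈ scale (f 0) (tail g) ⊕ tail f ⊛ g
tail-⊛ f g m = ⊛-suc f g m

⊛-assoc : ∀ f g h → (f ⊛ g) ⊛ h ≈ f ⊛ (g ⊛ h)
⊛-assoc f g h zero    = ℤP.*-assoc (f 0) (g 0) (h 0)
⊛-assoc f g h (suc m) = begin
  ((f ⊛ g) ⊛ h) (suc m)
    ≡⟨ ⊛-suc (f ⊛ g) h m ⟩
  f 0 * g 0 * h (suc m) + (tail (f ⊛ g) ⊛ h) m
    ≡⟨ cong (f 0 * g 0 * h (suc m) +_)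
            (trans (⊛-congˡ h (tail-⊛ f g) m) (⊛-distribʳ (scale (f 0) (tail g)) (tail f ⊛ g) h m)) ⟩
  f 0 * g 0 * h (suc m) + ((scale (f 0) (tail g) ⊛ h) m + ((tail f ⊛ g) ⊛ h) m)
    ≡⟨ cong₂ (λ a b → f 0 * g 0 * h (suc m) + (a + b)) (⊛-scaleˡ (f 0) (tail g) h m) (⊛-assoc (tail f) g h m) ⟩
  f 0 * g 0 * h (suc m) + (f 0 * (tail g ⊛ h) m + (tail f ⊛ (g ⊛ h)) m)
    ≡⟨ regroup (f 0) (g 0) (h (suc m)) _ _ ⟩
  f 0 * (g 0 * h (suc m) + (tail g ⊛ h) m) + (tail f ⊛ (g ⊛ h)) m
    ≡⟨ cong (λ z → f 0 * z + (tail f ⊛ (g ⊛ h)) m) (sym (⊛-suc g h m)) ⟩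
  f 0 * (g ⊛ h) (suc m) + (tail f ⊛ (g ⊛ h)) m
    ≡⟨ sym (⊛-suc f (g ⊛ h) m) ⟩
  (f ⊛ (g ⊛ h)) (suc m) ∎
  where
  open ≡-Reasoning
  regroup : ∀ a b c d e → a * b * c + (a * d + e) ≡ a * (b * c + d) + e
  regroup = solve-∀

⊛-comm : ∀ f g → f ⊛ g ≈ g ⊛ f
⊛-comm f g m = trans (sum0-reverse _ m) (sum0-cong m λ i i≤m →
  trans (cong (f (m ∸ i) *_) (cong g (ℕP.m∸[m∸n]≡n i≤m))) (ℤP.*-comm (f (m ∸ i)) (g i)))

⊛-identityˡ : ∀ f → one ⊛ f ≈ f
⊛-identityˡ f zero    = ℤP.*-identityˡ (f 0)
⊛-identityˡ f (suc m) = trans (⊛-suc one f m)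
  (trans (cong₂ _+_ (ℤP.*-identityˡ (f (suc m))) (⊛-zeroˡ f m)) (ℤP.+-identityʳ _))

⊛-identityʳ : ∀ f → f ⊛ one ≈ f
⊛-identityʳ f m = trans (⊛-comm f one m) (⊛-identityˡ f m)

⊛-zeroʳ : ∀ f → f ⊛ 0ˢ ≈ 0ˢ
⊛-zeroʳ f m = trans (⊛-comm f 0ˢ m) (⊛-zeroˡ f m)

≈-isEquivalence : IsEquivalence _≈_
≈-isEquivalence = record
  { refl  = λ _ → refl
  ; sym   = λ f≈g m → sym (f≈g m)
  ; trans = λ f≈g g≈h m → trans (f≈g m) (g≈h m)
  }

series-commutativeRing : CommutativeRing _ _
series-commutativeRing = record
  { Carrier = Series ; _≈_ = _≈_ ; _+_ = _⊕_ ; _*_ = _⊛_ ; -_ = ⊝_ ; 0# = 0ˢ ; 1# = one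
  ; isCommutativeRing = record
    { isRing = record
      { +-isAbelianGroup = record
        { isGroup = record
          { isMonoid = record
            { isSemigroup = record
              { isMagma = record
                { isEquivalence = ≈-isEquivalence
                ; ∙-cong = λ f≈f' g≈g' m → cong₂ _+_ (f≈f' m) (g≈g' m) }
              ; assoc = λ f g h m → ℤP.+-assoc (f m) (g m) (h m) }
            ; identity = (λ f m → ℤP.+-identityˡ (f m)) , (λ f m → ℤP.+-identityʳ (f m)) }
          ; inverse = (λ f m → ℤP.+-inverseˡ (f m)) , (λ f m → ℤP.+-inverseʳ (f m))
          ; ⁻¹-cong = λ f≈f' m → cong -_ (f≈f' m) }
        ; comm = λ f g m → ℤP.+-comm (f m) (g m) }
      ; *-cong = λ {f} {f'} {g} p q m → trans (⊛-congˡ g p m) (⊛-congʳ f' q m)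
      ; *-assoc = ⊛-assoc
      ; *-identity = ⊛-identityˡ , ⊛-identityʳ
      ; distrib = ⊛-distribˡ , (λ h f g → ⊛-distribʳ f g h) }
    ; *-comm = ⊛-comm } }

open CommutativeRing series-commutativeRing using ()
  renaming ( setoid to ≈-setoid; refl to ≈-refl; sym to ≈-sym; trans to ≈-trans
           ; +-cong to ⊕-cong; *-cong to ⊛-cong; -‿cong to ⊝-cong )

⊕-congˡ : ∀ {f f'} g → f ≈ f' → f ⊕ g ≈ f' ⊕ g
⊕-congˡ g f≈f' m = cong (_+ g m) (f≈f' m)

⊕-congʳ : ∀ f {g g'} → g ≈ g' → f ⊕ g ≈ f ⊕ g'
⊕-congʳ f g≈g' m = cong (f m +_) (g≈g' m)

mono-below : ∀ c j m → m < j → mono c j m ≡ 0ℤ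
mono-below c j m m<j with m ≡ᵇ j in eq
... | false = refl
... | true  = ⊥-elim (ℕP.<-irrefl (ℕP.≡ᵇ⇒≡ m j (subst T (sym eq) tt)) m<j)

mono-⊛-shift : ∀ c j f m → (mono c j ⊛ f) (j ℕ.+ m) ≡ c * f m
mono-⊛-shift c zero f zero    = refl
mono-⊛-shift c zero f (suc m) = trans (⊛-suc (mono c 0) f m)
  (trans (cong (c * f (suc m) +_) (⊛-zeroˡ f m)) (ℤP.+-identityʳ _))
mono-⊛-shift c (suc j) f m = trans (⊛-suc (mono c (suc j)) f (j ℕ.+ m))
  (trans (cong (0ℤ * f (suc (j ℕ.+ m)) +_) (mono-⊛-shift c j f m)) (ℤP.+-identityˡ _))

mono-neg : ∀ c j → mono (- c) j ≈ ⊝ mono c j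
mono-neg c j m with m ≡ᵇ j
... | true  = refl
... | false = refl

mono-cong : ∀ {c c' j j'} → c ≡ c' → j ≡ j' → mono c j ≈ mono c' j'
mono-cong refl refl m = refl

infix 4 q^_∣_

q^_∣_ : ℕ → Series → Set
q^ k ∣ f = ∀ m → m < k → f m ≡ 0ℤ

q^∣-weaken : ∀ {k k'} f → k' ≤ k → q^ k ∣ f → q^ k' ∣ f
q^∣-weaken f k'≤k q^k∣f m m<k' = q^k∣f m (ℕP.<-≤-trans m<k' k'≤k)

q^∣-resp-≈ : ∀ {k f g} → f ≈ g → q^ k ∣ f → q^ k ∣ g
q^∣-resp-≈ f≈g q^k∣f m m<k = trans (sym (f≈g m)) (q^k∣f m m<k)

q^∣0ˢ : ∀ k → q^ k ∣ 0ˢ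
q^∣0ˢ k m _ = refl

q^∣-⊕ : ∀ {k} f g → q^ k ∣ f → q^ k ∣ g → q^ k ∣ f ⊕ g
q^∣-⊕ f g q^k∣f q^k∣g m m<k = cong₂ _+_ (q^k∣f m m<k) (q^k∣g m m<k)

q^∣-⊝ : ∀ {k} f → q^ k ∣ f → q^ k ∣ ⊝ f
q^∣-⊝ f q^k∣f m m<k = cong -_ (q^k∣f m m<k)

q^∣-⊛ˡ : ∀ {k} f g → q^ k ∣ f → q^ k ∣ f ⊛ g
q^∣-⊛ˡ f g q^k∣f m m<k = trans
  (sum0-cong m (λ i i≤m → trans (cong (_* g (m ∸ i)) (q^k∣f i (ℕP.≤-<-trans i≤m m<k))) (ℤP.*-zeroˡ (g (m ∸ i)))))
  (sum0-zero m)

q^∣-⊛ʳ : ∀ {k} f g → q^ k ∣ g → q^ k ∣ f ⊛ g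
q^∣-⊛ʳ f g q^k∣g m m<k = trans
  (sum0-cong m (λ i _ → trans (cong (f i *_) (q^k∣g (m ∸ i) (ℕP.≤-<-trans (ℕP.m∸n≤m m i) m<k)))
                              (ℤP.*-zeroʳ (f i))))
  (sum0-zero m)

q^∣mono : ∀ c j → q^ j ∣ mono c j
q^∣mono = mono-below

q^∣mono-⊛ : ∀ {k} c j f → k ≤ j → q^ k ∣ mono c j ⊛ f
q^∣mono-⊛ c j f k≤j = q^∣-⊛ˡ (mono c j) f (q^∣-weaken (mono c j) k≤j (q^∣mono c j))

mono-⊛-mono : ∀ a b i j → mono a i ⊛ mono b j ≈ mono (a * b) (i ℕ.+ j)
mono-⊛-mono a b i j m with m ℕ.<? i
... | yes m<i = trans (q^∣-⊛ˡ (mono a i) (mono b j) (q^∣mono a i) m m<i)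
                      (sym (mono-below (a * b) (i ℕ.+ j) m (ℕP.<-≤-trans m<i (ℕP.m≤m+n i j))))
... | no m≮i  = subst (λ n → (mono a i ⊛ mono b j) n ≡ mono (a * b) (i ℕ.+ j) n)
                      (ℕP.m+[n∸m]≡n (ℕP.≮⇒≥ m≮i))
  (trans (mono-⊛-shift a i (mono b j) (m ∸ i))
  (trans (scale-if (m ∸ i ≡ᵇ j))
         (cong (λ t → if t then a * b else 0ℤ) (sym (≡ᵇ-+ˡ i (m ∸ i) j)))))
  where
  scale-if : ∀ t → a * (if t then b else 0ℤ) ≡ (if t then a * b else 0ℤ)
  scale-if false = ℤP.*-zeroʳ a
  scale-if true  = refl
  ≡ᵇ-+ˡ : ∀ i a b → (i ℕ.+ a ≡ᵇ i ℕ.+ b) ≡ (a ≡ᵇ b)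
  ≡ᵇ-+ˡ zero    a b = refl
  ≡ᵇ-+ˡ (suc i) a b = ≡ᵇ-+ˡ i a b

X : ℕ → Series
X = mono 1ℤ

mono-split : ∀ c {n} i j → i ℕ.+ j ≡ n → mono c n ≈ mono c i ⊛ X j
mono-split c i j i+j≡n = ≈-sym (≈-trans (mono-⊛-mono c 1ℤ i j) (mono-cong (ℤP.*-identityʳ c) i+j≡n))

oneMinus-neg1 : ∀ j → oneMinus (- 1ℤ) j ≈ one ⊕ X j
oneMinus-neg1 j m with m ≡ᵇ j
... | true  = refl
... | false = refl

oneMinus-cong : ∀ c {j j'} → j ≡ j' → oneMinus c j ≈ oneMinus c j'
oneMinus-cong c refl m = refl

const : ℤ → Series
const c = mono c 0

private
  ℤ-rawRing : RawRing _ _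
  ℤ-rawRing = CommutativeRing.rawRing ℤP.+-*-commutativeRing

  series-almostCommutativeRing : ACR.AlmostCommutativeRing _ _
  series-almostCommutativeRing = ACR.fromCommutativeRing series-commutativeRing

  const-homomorphism : ℤ-rawRing ACR.-Raw-AlmostCommutative⟶ series-almostCommutativeRing
  const-homomorphism = record
    { ⟦_⟧    = const
    ; +-homo = λ a b m → if-+ a b (m ≡ᵇ 0)
    ; *-homo = λ a b → ≈-sym (mono-⊛-mono a b 0 0)
    ; -‿homo = λ a → mono-neg a 0
    ; 0-homo = λ m → if-0 (m ≡ᵇ 0)
    ; 1-homo = λ m → refl }
    where
    if-+ : ∀ a b t → (if t then a + b else 0ℤ) ≡ (if t then a else 0ℤ) + (if t then b else 0ℤ)
    if-+ a b true  = refl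
    if-+ a b false = refl
    if-0 : ∀ t → (if t then 0ℤ else 0ℤ) ≡ 0ℤ
    if-0 true  = refl
    if-0 false = refl

  const-≟ : ∀ a b → Maybe (const a ≈ const b)
  const-≟ a b with a ℤ.≟ b
  ... | yes refl = just (λ m → refl)
  ... | no _     = nothing

open Algebra.Solver.Ring ℤ-rawRing series-almostCommutativeRing const-homomorphism const-≟
  using (solve; _:=_; _:+_; _:*_; :-_; _:-_; con)

-- Inverses

private
  -- `dot` is private to Defs, so the type of `dot≡prefixDot` cannot be written and is left to unification.
  prefixDot : Series → ℕ → List ℤ → ℤ
  prefixDot f k []       = 0ℤ
  prefixDot f k (x ∷ xs) = f (suc k) * x + prefixDot f (suc k) xs

  prefixDot-invPrefix : ∀ f k n →
    prefixDot f k (invPrefix f n) ≡ sum0 (λ i → f (suc k ℕ.+ i) * inv f (n ∸ i)) n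
  prefixDot-invPrefix f k zero =
    trans (ℤP.+-identityʳ _) (cong (λ z → f z * 1ℤ) (sym (ℕP.+-identityʳ (suc k))))
  prefixDot-invPrefix f k (suc n) =
    trans (cong (f (suc k) * inv f (suc n) +_) (prefixDot-invPrefix f (suc k) n))
    (trans (cong₂ (λ a b → f a * inv f (suc n) + b) (sym (ℕP.+-identityʳ (suc k)))
                  (sum0-cong n (λ i _ → cong (λ z → f z * inv f (n ∸ i)) (sym (ℕP.+-suc (suc k) i)))))
           (sym (sum0-sucˡ (λ i → f (suc k ℕ.+ i) * inv f (suc n ∸ i)) n)))

  mutual
    dot≡prefixDot : (f : Series) (k : ℕ) (xs : List ℤ) → _
    dot≡prefixDot f k []       = refl
    dot≡prefixDot f k (x ∷ xs) = cong (f (suc k) * x +_) (dot≡prefixDot f (suc k) xs)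

    inv-suc′ : ∀ f n → inv f (suc n) ≡ - prefixDot f 0 (invPrefix f n)
    inv-suc′ f n with invPrefix f n | 0
    ... | xs | k = cong -_ (dot≡prefixDot f k xs)

inv-suc : ∀ f n → inv f (suc n) ≡ - (tail f ⊛ inv f) n
inv-suc f n = trans (inv-suc′ f n) (cong -_ (prefixDot-invPrefix f 0 n))

⊛-inverseʳ : ∀ f → f 0 ≡ 1ℤ → f ⊛ inv f ≈ one
⊛-inverseʳ f f₀≡1 zero    = cong (_* 1ℤ) f₀≡1
⊛-inverseʳ f f₀≡1 (suc m) = begin
  (f ⊛ inv f) (suc m)                              ≡⟨ ⊛-suc f (inv f) m ⟩
  f 0 * inv f (suc m) + (tail f ⊛ inv f) m         ≡⟨ cong₂ (λ a b → a * b + (tail f ⊛ inv f) m) f₀≡1 (inv-suc f m) ⟩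
  1ℤ * - (tail f ⊛ inv f) m + (tail f ⊛ inv f) m   ≡⟨ cong (_+ (tail f ⊛ inv f) m) (ℤP.*-identityˡ (- (tail f ⊛ inv f) m)) ⟩
  - (tail f ⊛ inv f) m + (tail f ⊛ inv f) m        ≡⟨ ℤP.+-inverseˡ ((tail f ⊛ inv f) m) ⟩
  0ℤ ∎
  where open ≡-Reasoning

inv-unique : ∀ f g → f 0 ≡ 1ℤ → f ⊛ g ≈ one → g ≈ inv f
inv-unique f g f₀≡1 fg≈1 = begin
  g                  ≈⟨ ≈-sym (⊛-identityˡ g) ⟩
  one ⊛ g            ≈⟨ ⊛-congˡ g (≈-sym (⊛-inverseʳ f f₀≡1)) ⟩
  (f ⊛ inv f) ⊛ g    ≈⟨ ⊛-congˡ g (⊛-comm f (inv f)) ⟩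
  (inv f ⊛ f) ⊛ g    ≈⟨ ⊛-assoc (inv f) f g ⟩
  inv f ⊛ (f ⊛ g)    ≈⟨ ⊛-congʳ (inv f) fg≈1 ⟩
  inv f ⊛ one        ≈⟨ ⊛-identityʳ (inv f) ⟩
  inv f ∎
  where open SetoidReasoning ≈-setoid

inv-cong : ∀ {f f'} → f 0 ≡ 1ℤ → f ≈ f' → inv f ≈ inv f'
inv-cong {f} {f'} f₀≡1 f≈f' = inv-unique f' (inv f) (trans (sym (f≈f' 0)) f₀≡1)
  (≈-trans (⊛-congˡ (inv f) (≈-sym f≈f')) (⊛-inverseʳ f f₀≡1))

inv-one : inv one ≈ one
inv-one = ≈-sym (inv-unique one one refl (⊛-identityˡ one))

inv-via-multiple : ∀ f g h → f 0 ≡ 1ℤ → g 0 ≡ 1ℤ → f ⊛ g ≈ h → inv f ≈ g ⊛ inv h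
inv-via-multiple f g h f₀≡1 g₀≡1 fg≈h = ≈-sym (inv-unique f (g ⊛ inv h) f₀≡1 (begin
  f ⊛ (g ⊛ inv h)   ≈⟨ ≈-sym (⊛-assoc f g (inv h)) ⟩
  (f ⊛ g) ⊛ inv h   ≈⟨ ⊛-congˡ (inv h) fg≈h ⟩
  h ⊛ inv h         ≈⟨ ⊛-inverseʳ h (trans (sym (fg≈h 0)) (cong₂ _*_ f₀≡1 g₀≡1)) ⟩
  one ∎))
  where open SetoidReasoning ≈-setoid

q^∣-cancel-unit : ∀ {k} f g → f 0 ≡ 1ℤ → q^ k ∣ f ⊛ g → q^ k ∣ g
q^∣-cancel-unit f g f₀≡1 q^k∣fg = q^∣-resp-≈ inv-f⊛fg≈g (q^∣-⊛ʳ (inv f) (f ⊛ g) q^k∣fg)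
  where
  inv-f⊛fg≈g : inv f ⊛ (f ⊛ g) ≈ g
  inv-f⊛fg≈g = ≈-trans (≈-sym (⊛-assoc (inv f) f g))
    (≈-trans (⊛-congˡ g (≈-trans (⊛-comm (inv f) f) (⊛-inverseʳ f f₀≡1))) (⊛-identityˡ g))

-- The substitution q ↦ -q

sgn-+ : ∀ a b → sgn (a ℕ.+ b) ≡ sgn a * sgn b
sgn-+ zero    b = sym (ℤP.*-identityˡ (sgn b))
sgn-+ (suc a) b = trans (cong -_ (sgn-+ a b)) (ℤP.neg-distribˡ-* (sgn a) (sgn b))

sgn-2* : ∀ k → sgn (2 ℕ.* k) ≡ 1ℤ
sgn-2* zero    = refl
sgn-2* (suc k) = trans (cong sgn (ℕP.*-suc 2 k)) (trans (ℤP.neg-involutive (sgn (2 ℕ.* k))) (sgn-2* k))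

negArg-cong : ∀ {f g} → f ≈ g → negArg f ≈ negArg g
negArg-cong f≈g m = cong (sgn m *_) (f≈g m)

negArg-⊛ : ∀ f g → negArg (f ⊛ g) ≈ negArg f ⊛ negArg g
negArg-⊛ f g m = trans (sym (sum0-*ˡ (sgn m) _ m)) (sum0-cong m (λ i i≤m →
  trans (cong (λ n → sgn n * (f i * g (m ∸ i))) (sym (ℕP.m+[n∸m]≡n i≤m)))
  (trans (cong (_* (f i * g (m ∸ i))) (sgn-+ i (m ∸ i))) (interchange (sgn i) (sgn (m ∸ i)) (f i) (g (m ∸ i))))))
  where
  interchange : ∀ a b x y → a * b * (x * y) ≡ a * x * (b * y)
  interchange = solve-∀

negArg-mono : ∀ c j → negArg (mono c j) ≈ mono (sgn j * c) j
negArg-mono c j m with m ≡ᵇ j in eq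
... | true  = cong (λ n → sgn n * c) (ℕP.≡ᵇ⇒≡ m j (subst T (sym eq) tt))
... | false = ℤP.*-zeroʳ (sgn m)

negArg-one : negArg one ≈ one
negArg-one = negArg-mono 1ℤ 0

negArg-oneMinus : ∀ c j → negArg (oneMinus c j) ≈ oneMinus (sgn j * c) j
negArg-oneMinus c j m = trans (ℤP.*-distribˡ-+ (sgn m) (one m) (- mono c j m))
  (cong₂ _+_ (negArg-one m)
             (trans (sym (ℤP.neg-distribʳ-* (sgn m) (mono c j m))) (cong -_ (negArg-mono c j m))))

negArg-inv : ∀ f → f 0 ≡ 1ℤ → negArg (inv f) ≈ inv (negArg f)
negArg-inv f f₀≡1 = inv-unique (negArg f) (negArg (inv f)) (trans (ℤP.*-identityˡ (f 0)) f₀≡1)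
  (≈-trans (≈-sym (negArg-⊛ f (inv f))) (≈-trans (negArg-cong (⊛-inverseʳ f f₀≡1)) negArg-one))

-- q-Pochhammer symbols

poch-constant : ∀ c e d n → poch c (suc e) d n 0 ≡ 1ℤ
poch-constant c e d zero    = refl
poch-constant c e d (suc n) = cong (_* 1ℤ) (poch-constant c e d n)

poch-sucˡ : ∀ c e d n → poch c e d (suc n) ≈ oneMinus c e ⊛ poch c (e ℕ.+ d) d n
poch-sucˡ c e d zero = begin
  one ⊛ oneMinus c (e ℕ.+ d ℕ.* 0)   ≈⟨ ⊛-identityˡ _ ⟩
  oneMinus c (e ℕ.+ d ℕ.* 0)         ≈⟨ oneMinus-cong c (trans (cong (e ℕ.+_) (ℕP.*-zeroʳ d)) (ℕP.+-identityʳ e)) ⟩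
  oneMinus c e                       ≈⟨ ≈-sym (⊛-identityʳ (oneMinus c e)) ⟩
  oneMinus c e ⊛ one ∎
  where open SetoidReasoning ≈-setoid
poch-sucˡ c e d (suc n) = begin
  poch c e d (suc n) ⊛ oneMinus c (e ℕ.+ d ℕ.* suc n)
    ≈⟨ ⊛-cong (poch-sucˡ c e d n) (oneMinus-cong c e+d[1+n]≡e+d+dn) ⟩
  (oneMinus c e ⊛ poch c (e ℕ.+ d) d n) ⊛ oneMinus c (e ℕ.+ d ℕ.+ d ℕ.* n)
    ≈⟨ ⊛-assoc (oneMinus c e) (poch c (e ℕ.+ d) d n) (oneMinus c (e ℕ.+ d ℕ.+ d ℕ.* n)) ⟩
  oneMinus c e ⊛ poch c (e ℕ.+ d) d (suc n) ∎
  where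
  open SetoidReasoning ≈-setoid
  e+d[1+n]≡e+d+dn : e ℕ.+ d ℕ.* suc n ≡ e ℕ.+ d ℕ.+ d ℕ.* n
  e+d[1+n]≡e+d+dn = trans (cong (e ℕ.+_) (ℕP.*-suc d n)) (sym (ℕP.+-assoc e d (d ℕ.* n)))

negArg-poch-even : ∀ c a b n → negArg (poch c (2 ℕ.* a) (2 ℕ.* b) n) ≈ poch c (2 ℕ.* a) (2 ℕ.* b) n
negArg-poch-even c a b zero    = negArg-one
negArg-poch-even c a b (suc n) =
  ≈-trans (negArg-⊛ (poch c (2 ℕ.* a) (2 ℕ.* b) n) (oneMinus c j))
          (⊛-cong (negArg-poch-even c a b n)
                  (≈-trans (negArg-oneMinus c j) (λ m → cong (λ s → oneMinus s j m) sgn-j*c≡c)))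
  where
  j : ℕ
  j = 2 ℕ.* a ℕ.+ 2 ℕ.* b ℕ.* n
  sgn-j*c≡c : sgn j * c ≡ c
  sgn-j*c≡c = begin
    sgn j * c                                          ≡⟨ cong (_* c) (sgn-+ (2 ℕ.* a) (2 ℕ.* b ℕ.* n)) ⟩
    sgn (2 ℕ.* a) * sgn (2 ℕ.* b ℕ.* n) * c           ≡⟨ cong₂ (λ s t → s * t * c) (sgn-2* a)
                                                            (trans (cong sgn (ℕP.*-assoc 2 b n)) (sgn-2* (b ℕ.* n))) ⟩
    1ℤ * 1ℤ * c                                        ≡⟨ ℤP.*-identityˡ c ⟩
    c ∎
    where open ≡-Reasoning

poch-interleave : ∀ c j → poch c 2 2 j ⊛ poch c 1 2 j ≈ poch c 1 1 (2 ℕ.* j)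
poch-interleave c zero    = ⊛-identityˡ one
poch-interleave c (suc j) = begin
  (poch c 2 2 j ⊛ oneMinus c (2 ℕ.+ 2 ℕ.* j)) ⊛ (poch c 1 2 j ⊛ oneMinus c (1 ℕ.+ 2 ℕ.* j))
    ≈⟨ solve 4 (λ a b p q → (a :* p) :* (b :* q) := ((a :* b) :* q) :* p) (λ _ → refl)
         (poch c 2 2 j) (poch c 1 2 j) (oneMinus c (2 ℕ.+ 2 ℕ.* j)) (oneMinus c (1 ℕ.+ 2 ℕ.* j)) ⟩
  ((poch c 2 2 j ⊛ poch c 1 2 j) ⊛ oneMinus c (1 ℕ.+ 2 ℕ.* j)) ⊛ oneMinus c (2 ℕ.+ 2 ℕ.* j)
    ≈⟨ ⊛-cong (⊛-cong (poch-interleave c j) (oneMinus-cong c (cong suc (sym (ℕP.*-identityˡ (2 ℕ.* j))))))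
              (oneMinus-cong c (cong suc (sym (ℕP.*-identityˡ (suc (2 ℕ.* j)))))) ⟩
  poch c 1 1 (suc (suc (2 ℕ.* j)))
    ≈⟨ (λ m → cong (λ n → poch c 1 1 n m) (sym (ℕP.*-suc 2 j))) ⟩
  poch c 1 1 (2 ℕ.* suc j) ∎
  where open SetoidReasoning ≈-setoid

Pq Dq : ℕ → ℕ → Series
Pq e = poch 1ℤ e 2
Dq e = poch (- 1ℤ) e 2

-- The functional equation

sumBelow : (ℕ → Series) → ℕ → Series
sumBelow f zero    = 0ˢ
sumBelow f (suc M) = sumBelow f M ⊕ f M

sumBelow-telescope : ∀ (f w : ℕ → Series) → (∀ j → f j ≈ w (suc j) ⊖ w j) → ∀ M → sumBelow f M ≈ w M ⊖ w 0
sumBelow-telescope f w f≈Δw zero    m = sym (ℤP.+-inverseʳ (w 0 m))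
sumBelow-telescope f w f≈Δw (suc M) = begin
  sumBelow f M ⊕ f M                        ≈⟨ ⊕-cong (sumBelow-telescope f w f≈Δw M) (f≈Δw M) ⟩
  (w M ⊖ w 0) ⊕ (w (suc M) ⊖ w M)           ≈⟨ solve 3 (λ a b c → (b :- a) :+ (c :- b) := c :- a) (λ _ → refl)
                                                  (w 0) (w M) (w (suc M)) ⟩
  w (suc M) ⊖ w 0 ∎
  where open SetoidReasoning ≈-setoid

Φ : ℕ → (ℕ → Series) → Series
Φ e F = (one ⊕ X e) ⊛ F e ⊕ (one ⊖ X e) ⊛ F (e ℕ.+ 2)

Φ-⊕ : ∀ e F G → Φ e (λ e' → F e' ⊕ G e') ≈ Φ e F ⊕ Φ e G
Φ-⊕ e F G = solve 5 (λ t a a' b b' → (con 1ℤ :+ t) :* (a :+ b) :+ (con 1ℤ :- t) :* (a' :+ b')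
                              := ((con 1ℤ :+ t) :* a :+ (con 1ℤ :- t) :* a')
                                 :+ ((con 1ℤ :+ t) :* b :+ (con 1ℤ :- t) :* b'))
                    (λ _ → refl) (X e) (F e) (F (e ℕ.+ 2)) (G e) (G (e ℕ.+ 2))

Φ-⊖ : ∀ e F G → Φ e (λ e' → F e' ⊖ G e') ≈ Φ e F ⊖ Φ e G
Φ-⊖ e F G = solve 5 (λ t a a' b b' → (con 1ℤ :+ t) :* (a :- b) :+ (con 1ℤ :- t) :* (a' :- b')
                              := ((con 1ℤ :+ t) :* a :+ (con 1ℤ :- t) :* a')
                                 :- ((con 1ℤ :+ t) :* b :+ (con 1ℤ :- t) :* b'))
                    (λ _ → refl) (X e) (F e) (F (e ℕ.+ 2)) (G e) (G (e ℕ.+ 2))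

Φ-sumBelow-telescope : ∀ e (F : ℕ → ℕ → Series) (w : ℕ → Series) → (∀ j → Φ e (λ e' → F e' j) ≈ w (suc j) ⊖ w j) →
                       ∀ M → Φ e (λ e' → sumBelow (F e') M) ≈ w M ⊖ w 0
Φ-sumBelow-telescope e F w ΦF≈Δw M = ≈-trans (Φ-sumBelow M) (sumBelow-telescope _ w ΦF≈Δw M)
  where
  Φ-sumBelow : ∀ M → Φ e (λ e' → sumBelow (F e') M) ≈ sumBelow (λ j → Φ e (λ e' → F e' j)) M
  Φ-sumBelow zero    = ⊕-cong (⊛-zeroʳ (one ⊕ X e)) (⊛-zeroʳ (one ⊖ X e))
  Φ-sumBelow (suc M) = ≈-trans (Φ-⊕ e (λ e' → sumBelow (F e') M) (λ e' → F e' M))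
                               (⊕-congˡ (Φ e (λ e' → F e' M)) (Φ-sumBelow M))

descent : ∀ N (D : ℕ → Series) → (∀ e → q^ suc e ∣ D (suc e)) → (∀ e → q^ N ∣ Φ (suc e) D) →
          ∀ e → q^ N ∣ D (suc e)
descent N D q^e∣D q^N∣ΦD e = go N e (ℕP.m≤n+m N (suc e))
  where
  go : ∀ j e → N ≤ suc e ℕ.+ j → q^ N ∣ D (suc e)
  go zero    e N≤e+1   = q^∣-weaken (D (suc e)) (subst (N ≤_) (ℕP.+-identityʳ (suc e)) N≤e+1) (q^e∣D e)
  go (suc j) e N≤e+j+2 = q^∣-cancel-unit (one ⊕ t) (D (suc e)) refl q^N∣[1+t]D
    where
    t : Series
    t = X (suc e)
    q^N∣Dₑ₊₂ : q^ N ∣ D (suc e ℕ.+ 2)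
    q^N∣Dₑ₊₂ = go j (e ℕ.+ 2) (ℕP.≤-trans N≤e+j+2 (ℕP.≤-trans (ℕP.≤-reflexive (shuffle e j)) (ℕP.n≤1+n _)))
      where
      shuffle : ∀ a b → suc a ℕ.+ suc b ≡ a ℕ.+ 2 ℕ.+ b
      shuffle = ℕSolver.solve-∀
    q^N∣[1+t]D : q^ N ∣ (one ⊕ t) ⊛ D (suc e)
    q^N∣[1+t]D = q^∣-resp-≈
      (solve 2 (λ a b → (a :+ b) :- b := a) (λ _ → refl) ((one ⊕ t) ⊛ D (suc e)) ((one ⊖ t) ⊛ D (suc e ℕ.+ 2)))
      (q^∣-⊕ (Φ (suc e) D) _ (q^N∣ΦD e) (q^∣-⊝ _ (q^∣-⊛ʳ (one ⊖ t) (D (suc e ℕ.+ 2)) q^N∣Dₑ₊₂)))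

-- The family A_e

inv-Dq₂ : ∀ n → inv (Dq 2 n) ≈ (one ⊕ X (2 ℕ.+ 2 ℕ.* n)) ⊛ inv (Dq 2 (suc n))
inv-Dq₂ n = ≈-trans (inv-via-multiple (Dq 2 n) (oneMinus (- 1ℤ) (2 ℕ.+ 2 ℕ.* n)) (Dq 2 (suc n))
                                     (poch-constant (- 1ℤ) 1 2 n) refl ≈-refl)
                   (⊛-congˡ (inv (Dq 2 (suc n))) (oneMinus-neg1 (2 ℕ.+ 2 ℕ.* n)))

aTerm : ℕ → ℕ → Series
aTerm e n = mono (sgn n) (e ℕ.* n) ⊛ Pq 2 (n ∸ 1) ⊛ inv (Dq 2 n)

A : ℕ → ℕ → Series
A e M = sumBelow (λ j → aTerm e (suc j)) M

Aerr : ℕ → ℕ → Series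
Aerr e M = mono (sgn M) (e ℕ.* suc M) ⊛ Pq 2 M ⊛ inv (Dq 2 M)

Φ-aTerm : ∀ e k → Φ e (λ e' → aTerm e' (suc k)) ≈ Aerr e (suc k) ⊖ Aerr e k
Φ-aTerm e k = begin
  Φ e (λ e' → aTerm e' (suc k))
    ≈⟨ ⊕-cong (⊛-congʳ (one ⊕ t) aₑ) (⊛-congʳ (one ⊖ t) aₑ₊₂) ⟩
  (one ⊕ t) ⊛ (⊝ c ⊛ P ⊛ I) ⊕ (one ⊖ t) ⊛ (⊝ c ⊛ y ⊛ P ⊛ I)
    ≈⟨ solve 5 (λ t c y P I → (con 1ℤ :+ t) :* ((:- c) :* P :* I) :+ (con 1ℤ :- t) :* ((:- c) :* y :* P :* I)
                             := (:- c) :* t :* (P :* (con 1ℤ :- y)) :* I :- c :* P :* ((con 1ℤ :+ y) :* I))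
               (λ _ → refl) t c y P I ⟩
  ⊝ c ⊛ t ⊛ (P ⊛ (one ⊖ y)) ⊛ I ⊖ c ⊛ P ⊛ ((one ⊕ y) ⊛ I)
    ≈⟨ ≈-sym (⊕-cong errₖ₊₁ (⊝-cong errₖ)) ⟩
  Aerr e (suc k) ⊖ Aerr e k ∎
  where
  open SetoidReasoning ≈-setoid
  t c y P I : Series
  t = X e
  c = mono (sgn k) (e ℕ.* suc k)
  y = X (2 ℕ.+ 2 ℕ.* k)
  P = Pq 2 k
  I = inv (Dq 2 (suc k))
  aₑ : aTerm e (suc k) ≈ ⊝ c ⊛ P ⊛ I
  aₑ = ⊛-congˡ I (⊛-congˡ P (mono-neg (sgn k) (e ℕ.* suc k)))
  aₑ₊₂ : aTerm (e ℕ.+ 2) (suc k) ≈ ⊝ c ⊛ y ⊛ P ⊛ I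
  aₑ₊₂ = ⊛-congˡ I (⊛-congˡ P (≈-trans (mono-split (- sgn k) (e ℕ.* suc k) (2 ℕ.+ 2 ℕ.* k) (exponent e k))
                                        (⊛-congˡ y (mono-neg (sgn k) (e ℕ.* suc k)))))
    where
    exponent : ∀ e k → e ℕ.* suc k ℕ.+ (2 ℕ.+ 2 ℕ.* k) ≡ (e ℕ.+ 2) ℕ.* suc k
    exponent = ℕSolver.solve-∀
  errₖ₊₁ : Aerr e (suc k) ≈ ⊝ c ⊛ t ⊛ (P ⊛ (one ⊖ y)) ⊛ I
  errₖ₊₁ = ⊛-congˡ I (⊛-congˡ (Pq 2 (suc k)) (≈-trans (mono-split (- sgn k) (e ℕ.* suc k) e (exponent e k))
                                                      (⊛-congˡ t (mono-neg (sgn k) (e ℕ.* suc k)))))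
    where
    exponent : ∀ e k → e ℕ.* suc k ℕ.+ e ≡ e ℕ.* suc (suc k)
    exponent = ℕSolver.solve-∀
  errₖ : Aerr e k ≈ c ⊛ P ⊛ ((one ⊕ y) ⊛ I)
  errₖ = ⊛-congʳ (c ⊛ P) (inv-Dq₂ k)

Aerr-zero : ∀ e → Aerr e 0 ≈ X e
Aerr-zero e = begin
  mono 1ℤ (e ℕ.* 1) ⊛ one ⊛ inv one   ≈⟨ ⊛-congʳ (mono 1ℤ (e ℕ.* 1) ⊛ one) inv-one ⟩
  mono 1ℤ (e ℕ.* 1) ⊛ one ⊛ one       ≈⟨ ≈-trans (⊛-identityʳ _) (⊛-identityʳ _) ⟩
  mono 1ℤ (e ℕ.* 1)                   ≈⟨ mono-cong refl (ℕP.*-identityʳ e) ⟩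
  X e ∎
  where open SetoidReasoning ≈-setoid

Φ-A : ∀ e M → Φ e (λ e' → A e' M) ≈ Aerr e M ⊖ X e
Φ-A e M = ≈-trans (Φ-sumBelow-telescope e (λ e' j → aTerm e' (suc j)) (Aerr e) (Φ-aTerm e) M)
                  (⊕-congʳ (Aerr e M) (⊝-cong (Aerr-zero e)))

q^∣aTerm : ∀ e n → q^ (e ℕ.* n) ∣ aTerm e n
q^∣aTerm e n = q^∣-⊛ˡ _ (inv (Dq 2 n)) (q^∣mono-⊛ (sgn n) (e ℕ.* n) (Pq 2 (n ∸ 1)) ℕP.≤-refl)

q^∣A : ∀ e M → q^ e ∣ A e M
q^∣A e zero    = q^∣0ˢ e
q^∣A e (suc M) = q^∣-⊕ (A e M) (aTerm e (suc M)) (q^∣A e M)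
  (q^∣-weaken (aTerm e (suc M)) (ℕP.m≤m*n e (suc M)) (q^∣aTerm e (suc M)))

q^∣Aerr : ∀ e M → q^ (e ℕ.* suc M) ∣ Aerr e M
q^∣Aerr e M = q^∣-⊛ˡ _ (inv (Dq 2 M)) (q^∣mono-⊛ (sgn M) (e ℕ.* suc M) (Pq 2 M) ℕP.≤-refl)

-- The family B_e

bExp : ℕ → ℕ → ℕ
bExp e j = (e ℕ.+ 2 ℕ.* j) ℕ.* suc j

bTerm : ℕ → ℕ → Series
bTerm e j = ⊝ (X (bExp e j) ⊛ Pq 2 j ⊛ Pq e j ⊛ (one ⊕ X (e ℕ.+ 4 ℕ.* j ℕ.+ 2))
                ⊛ inv (Dq 2 (suc j) ⊛ Dq e (suc j)))

B : ℕ → ℕ → Series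
B e M = sumBelow (bTerm e) M

Berr : ℕ → ℕ → Series
Berr e M = X (bExp e M) ⊛ Pq 2 M ⊛ Pq e M ⊛ inv (Dq 2 M ⊛ Dq (e ℕ.+ 2) M)

X-split : ∀ {n} i j → i ℕ.+ j ≡ n → X n ≈ X i ⊛ X j
X-split = mono-split 1ℤ

module _ (e′ M : ℕ) where
  private
    e : ℕ
    e = suc e′
    Z P N K t x v G H I : Series
    Z = X (bExp e M)
    P = Pq 2 M
    N = Pq e M
    K = Pq (e ℕ.+ 2) M
    t = X e
    x = X (2 ℕ.+ 2 ℕ.* M)
    v = X (e ℕ.+ 2 ℕ.* M)
    G = Dq 2 M
    H = Dq (e ℕ.+ 2) M
    I = inv (G ⊛ H ⊛ (one ⊕ x) ⊛ (one ⊕ t) ⊛ (one ⊕ t ⊛ x))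

    G₀≡1 : G 0 ≡ 1ℤ
    G₀≡1 = poch-constant (- 1ℤ) 1 2 M
    Dq₂-suc : Dq 2 (suc M) ≈ G ⊛ (one ⊕ x)
    Dq₂-suc = ⊛-congʳ G (oneMinus-neg1 (2 ℕ.+ 2 ℕ.* M))

    inv-bTermₑ : inv (Dq 2 (suc M) ⊛ Dq e (suc M)) ≈ (one ⊕ t ⊛ x) ⊛ I
    inv-bTermₑ = inv-via-multiple _ (one ⊕ t ⊛ x) _
      (cong₂ _*_ (poch-constant (- 1ℤ) 1 2 (suc M)) (poch-constant (- 1ℤ) e′ 2 (suc M))) refl
      (≈-trans (⊛-congˡ (one ⊕ t ⊛ x) (⊛-cong Dq₂-suc (≈-trans (poch-sucˡ (- 1ℤ) e 2 M) (⊛-congˡ H (oneMinus-neg1 e)))))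
        (solve 5 (λ G H x t y → G :* (con 1ℤ :+ x) :* ((con 1ℤ :+ t) :* H) :* (con 1ℤ :+ y)
                            := G :* H :* (con 1ℤ :+ x) :* (con 1ℤ :+ t) :* (con 1ℤ :+ y))
               (λ _ → refl) G H x t (t ⊛ x)))

    inv-Berr-suc : inv (Dq 2 (suc M) ⊛ Dq (e ℕ.+ 2) (suc M)) ≈ (one ⊕ t) ⊛ I
    inv-Berr-suc = inv-via-multiple _ (one ⊕ t) _
      (cong₂ _*_ (poch-constant (- 1ℤ) 1 2 (suc M)) (poch-constant (- 1ℤ) (e′ ℕ.+ 2) 2 (suc M))) refl
      (≈-trans (⊛-congˡ (one ⊕ t) (⊛-cong Dq₂-suc (⊛-congʳ H
                 (≈-trans (oneMinus-neg1 (e ℕ.+ 2 ℕ.+ 2 ℕ.* M))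
                          (⊕-congʳ one (X-split e (2 ℕ.+ 2 ℕ.* M) (exponent e M)))))))
        (solve 5 (λ G H x t y → G :* (con 1ℤ :+ x) :* (H :* (con 1ℤ :+ y)) :* (con 1ℤ :+ t)
                            := G :* H :* (con 1ℤ :+ x) :* (con 1ℤ :+ t) :* (con 1ℤ :+ y))
               (λ _ → refl) G H x t (t ⊛ x)))
      where
      exponent : ∀ e M → e ℕ.+ (2 ℕ.+ 2 ℕ.* M) ≡ e ℕ.+ 2 ℕ.+ 2 ℕ.* M
      exponent = ℕSolver.solve-∀

    inv-Berr : inv (G ⊛ H) ≈ (one ⊕ x) ⊛ (one ⊕ t) ⊛ (one ⊕ t ⊛ x) ⊛ I
    inv-Berr = inv-via-multiple (G ⊛ H) ((one ⊕ x) ⊛ (one ⊕ t) ⊛ (one ⊕ t ⊛ x)) _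
      (cong₂ _*_ G₀≡1 (poch-constant (- 1ℤ) (e′ ℕ.+ 2) 2 M)) refl
      (solve 5 (λ G H x t y → G :* H :* ((con 1ℤ :+ x) :* (con 1ℤ :+ t) :* (con 1ℤ :+ y))
                          := G :* H :* (con 1ℤ :+ x) :* (con 1ℤ :+ t) :* (con 1ℤ :+ y))
             (λ _ → refl) G H x t (t ⊛ x))

    bTermₑ : bTerm e M ≈ ⊝ (Z ⊛ P ⊛ N ⊛ (one ⊕ v ⊛ x) ⊛ ((one ⊕ t ⊛ x) ⊛ I))
    bTermₑ = ⊝-cong (⊛-cong (⊛-congʳ (Z ⊛ P ⊛ N) (⊕-congʳ one (X-split (e ℕ.+ 2 ℕ.* M) (2 ℕ.+ 2 ℕ.* M) (exponent e M))))
                            inv-bTermₑ)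
      where
      exponent : ∀ e M → e ℕ.+ 2 ℕ.* M ℕ.+ (2 ℕ.+ 2 ℕ.* M) ≡ e ℕ.+ 4 ℕ.* M ℕ.+ 2
      exponent = ℕSolver.solve-∀

    [1-t]bTermₑ₊₂ : (one ⊖ t) ⊛ bTerm (e ℕ.+ 2) M ≈
                    ⊝ (Z ⊛ x ⊛ P ⊛ (N ⊛ (one ⊖ v)) ⊛ (one ⊕ t ⊛ x ⊛ x) ⊛ ((one ⊕ t) ⊛ I))
    [1-t]bTermₑ₊₂ = begin
      (one ⊖ t) ⊛ bTerm (e ℕ.+ 2) M
        ≈⟨ ⊛-congʳ (one ⊖ t) (⊝-cong (⊛-cong (⊛-cong (⊛-congˡ K (⊛-congˡ P Z⊛x)) (⊕-congʳ one t⊛x⊛x)) inv-Berr-suc)) ⟩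
      (one ⊖ t) ⊛ ⊝ (Z ⊛ x ⊛ P ⊛ K ⊛ (one ⊕ t ⊛ x ⊛ x) ⊛ ((one ⊕ t) ⊛ I))
        ≈⟨ solve 7 (λ t Z x P K y J → (con 1ℤ :- t) :* (:- (Z :* x :* P :* K :* y :* J))
                                   := :- (Z :* x :* P :* ((con 1ℤ :- t) :* K) :* y :* J))
                 (λ _ → refl) t Z x P K (one ⊕ t ⊛ x ⊛ x) ((one ⊕ t) ⊛ I) ⟩
      ⊝ (Z ⊛ x ⊛ P ⊛ ((one ⊖ t) ⊛ K) ⊛ (one ⊕ t ⊛ x ⊛ x) ⊛ ((one ⊕ t) ⊛ I))
        ≈⟨ ⊝-cong (⊛-congˡ ((one ⊕ t) ⊛ I) (⊛-congˡ (one ⊕ t ⊛ x ⊛ x) (⊛-congʳ (Z ⊛ x ⊛ P) (≈-sym (poch-sucˡ 1ℤ e 2 M))))) ⟩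
      ⊝ (Z ⊛ x ⊛ P ⊛ (N ⊛ (one ⊖ v)) ⊛ (one ⊕ t ⊛ x ⊛ x) ⊛ ((one ⊕ t) ⊛ I)) ∎
      where
      open SetoidReasoning ≈-setoid
      Z⊛x : X (bExp (e ℕ.+ 2) M) ≈ Z ⊛ x
      Z⊛x = X-split (bExp e M) (2 ℕ.+ 2 ℕ.* M) (exponent e M)
        where
        exponent : ∀ e M → (e ℕ.+ 2 ℕ.* M) ℕ.* suc M ℕ.+ (2 ℕ.+ 2 ℕ.* M) ≡ (e ℕ.+ 2 ℕ.+ 2 ℕ.* M) ℕ.* suc M
        exponent = ℕSolver.solve-∀
      t⊛x⊛x : X (e ℕ.+ 2 ℕ.+ 4 ℕ.* M ℕ.+ 2) ≈ t ⊛ x ⊛ x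
      t⊛x⊛x = ≈-trans (X-split (e ℕ.+ (2 ℕ.+ 2 ℕ.* M)) (2 ℕ.+ 2 ℕ.* M) (exponent e M))
                      (⊛-congˡ x (X-split e (2 ℕ.+ 2 ℕ.* M) refl))
        where
        exponent : ∀ e M → e ℕ.+ (2 ℕ.+ 2 ℕ.* M) ℕ.+ (2 ℕ.+ 2 ℕ.* M) ≡ e ℕ.+ 2 ℕ.+ 4 ℕ.* M ℕ.+ 2
        exponent = ℕSolver.solve-∀

    Berr-suc : Berr e (suc M) ≈ Z ⊛ t ⊛ x ⊛ x ⊛ (P ⊛ (one ⊖ x)) ⊛ (N ⊛ (one ⊖ v)) ⊛ ((one ⊕ t) ⊛ I)
    Berr-suc = ⊛-cong (⊛-congˡ (Pq e (suc M)) (⊛-congˡ (Pq 2 (suc M)) Z⊛t⊛x⊛x)) inv-Berr-suc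
      where
      Z⊛t⊛x⊛x : X (bExp e (suc M)) ≈ Z ⊛ t ⊛ x ⊛ x
      Z⊛t⊛x⊛x = ≈-trans (X-split (bExp e M ℕ.+ e ℕ.+ (2 ℕ.+ 2 ℕ.* M)) (2 ℕ.+ 2 ℕ.* M) (exponent e M))
                  (⊛-congˡ x (≈-trans (X-split (bExp e M ℕ.+ e) (2 ℕ.+ 2 ℕ.* M) refl)
                                      (⊛-congˡ x (X-split (bExp e M) e refl))))
        where
        exponent : ∀ e M → (e ℕ.+ 2 ℕ.* M) ℕ.* suc M ℕ.+ e ℕ.+ (2 ℕ.+ 2 ℕ.* M) ℕ.+ (2 ℕ.+ 2 ℕ.* M)
                           ≡ (e ℕ.+ 2 ℕ.* suc M) ℕ.* suc (suc M)
        exponent = ℕSolver.solve-∀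

  Φ-bTerm : Φ (suc e′) (λ e' → bTerm e' M) ≈ Berr (suc e′) (suc M) ⊖ Berr (suc e′) M
  Φ-bTerm = begin
    (one ⊕ t) ⊛ bTerm e M ⊕ (one ⊖ t) ⊛ bTerm (e ℕ.+ 2) M
      ≈⟨ ⊕-cong (⊛-congʳ (one ⊕ t) bTermₑ) [1-t]bTermₑ₊₂ ⟩
    (one ⊕ t) ⊛ ⊝ (Z ⊛ P ⊛ N ⊛ (one ⊕ v ⊛ x) ⊛ ((one ⊕ t ⊛ x) ⊛ I))
      ⊕ ⊝ (Z ⊛ x ⊛ P ⊛ (N ⊛ (one ⊖ v)) ⊛ (one ⊕ t ⊛ x ⊛ x) ⊛ ((one ⊕ t) ⊛ I))
      ≈⟨ solve 7 (λ Z P N t x v I →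
             (con 1ℤ :+ t) :* (:- (Z :* P :* N :* (con 1ℤ :+ v :* x) :* ((con 1ℤ :+ t :* x) :* I)))
             :+ (:- (Z :* x :* P :* (N :* (con 1ℤ :- v)) :* (con 1ℤ :+ t :* x :* x) :* ((con 1ℤ :+ t) :* I)))
          := Z :* t :* x :* x :* (P :* (con 1ℤ :- x)) :* (N :* (con 1ℤ :- v)) :* ((con 1ℤ :+ t) :* I)
             :- Z :* P :* N :* ((con 1ℤ :+ x) :* (con 1ℤ :+ t) :* (con 1ℤ :+ t :* x) :* I))
           (λ _ → refl) Z P N t x v I ⟩
    Z ⊛ t ⊛ x ⊛ x ⊛ (P ⊛ (one ⊖ x)) ⊛ (N ⊛ (one ⊖ v)) ⊛ ((one ⊕ t) ⊛ I)
      ⊖ Z ⊛ P ⊛ N ⊛ ((one ⊕ x) ⊛ (one ⊕ t) ⊛ (one ⊕ t ⊛ x) ⊛ I)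
      ≈⟨ ≈-sym (⊕-cong Berr-suc (⊝-cong (⊛-congʳ (Z ⊛ P ⊛ N) inv-Berr))) ⟩
    Berr e (suc M) ⊖ Berr e M ∎
    where open SetoidReasoning ≈-setoid

Berr-zero : ∀ e → Berr e 0 ≈ X e
Berr-zero e = begin
  X (bExp e 0) ⊛ one ⊛ one ⊛ inv (one ⊛ one)   ≈⟨ ⊛-congʳ (X (bExp e 0) ⊛ one ⊛ one)
                                                      (≈-trans (inv-cong refl (⊛-identityʳ one)) inv-one) ⟩
  X (bExp e 0) ⊛ one ⊛ one ⊛ one               ≈⟨ ≈-trans (⊛-identityʳ _) (≈-trans (⊛-identityʳ _) (⊛-identityʳ _)) ⟩
  X (bExp e 0)                                 ≈⟨ mono-cong refl (trans (ℕP.*-identityʳ (e ℕ.+ 0)) (ℕP.+-identityʳ e)) ⟩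
  X e ∎
  where open SetoidReasoning ≈-setoid

Φ-B : ∀ e M → Φ (suc e) (λ e' → B e' M) ≈ Berr (suc e) M ⊖ X (suc e)
Φ-B e M = ≈-trans (Φ-sumBelow-telescope (suc e) bTerm (Berr (suc e)) (Φ-bTerm e) M)
                  (⊕-congʳ (Berr (suc e) M) (⊝-cong (Berr-zero (suc e))))

q^∣bTerm : ∀ e j → q^ bExp e j ∣ bTerm e j
q^∣bTerm e j = q^∣-⊝ _ (q^∣-⊛ˡ _ (inv (Dq 2 (suc j) ⊛ Dq e (suc j))) (q^∣-⊛ˡ _ (one ⊕ X (e ℕ.+ 4 ℕ.* j ℕ.+ 2))
  (q^∣-⊛ˡ _ (Pq e j) (q^∣mono-⊛ 1ℤ (bExp e j) (Pq 2 j) ℕP.≤-refl))))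

e≤bExp : ∀ e j → e ≤ bExp e j
e≤bExp e j = ℕP.≤-trans (ℕP.m≤m+n e (2 ℕ.* j)) (ℕP.m≤m*n (e ℕ.+ 2 ℕ.* j) (suc j))

q^∣B : ∀ e M → q^ e ∣ B e M
q^∣B e zero    = q^∣0ˢ e
q^∣B e (suc M) = q^∣-⊕ (B e M) (bTerm e M) (q^∣B e M) (q^∣-weaken (bTerm e M) (e≤bExp e M) (q^∣bTerm e M))

q^∣Berr : ∀ e M → q^ bExp e M ∣ Berr e M
q^∣Berr e M = q^∣-⊛ˡ _ (inv (Dq 2 M ⊛ Dq (e ℕ.+ 2) M)) (q^∣-⊛ˡ _ (Pq e M) (q^∣mono-⊛ 1ℤ (bExp e M) (Pq 2 M) ℕP.≤-refl))

A≡B-mod-q^N : ∀ N → q^ N ∣ A 1 N ⊖ B 1 N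
A≡B-mod-q^N N = descent N (λ e → A e N ⊖ B e N) q^∣A⊖B q^N∣Φ[A⊖B] 0
  where
  q^∣A⊖B : ∀ e → q^ suc e ∣ A (suc e) N ⊖ B (suc e) N
  q^∣A⊖B e = q^∣-⊕ (A (suc e) N) _ (q^∣A (suc e) N) (q^∣-⊝ _ (q^∣B (suc e) N))
  q^N∣Φ[A⊖B] : ∀ e → q^ N ∣ Φ (suc e) (λ e' → A e' N ⊖ B e' N)
  q^N∣Φ[A⊖B] e = q^∣-resp-≈ (≈-sym (begin
    Φ (suc e) (λ e' → A e' N ⊖ B e' N)
      ≈⟨ Φ-⊖ (suc e) (λ e' → A e' N) (λ e' → B e' N) ⟩
    Φ (suc e) (λ e' → A e' N) ⊖ Φ (suc e) (λ e' → B e' N)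
      ≈⟨ ⊕-cong (Φ-A (suc e) N) (⊝-cong (Φ-B e N)) ⟩
    (Aerr (suc e) N ⊖ X (suc e)) ⊖ (Berr (suc e) N ⊖ X (suc e))
      ≈⟨ solve 3 (λ a b t → (a :- t) :- (b :- t) := a :- b) (λ _ → refl) (Aerr (suc e) N) (Berr (suc e) N) (X (suc e)) ⟩
    Aerr (suc e) N ⊖ Berr (suc e) N ∎))
    (q^∣-⊕ (Aerr (suc e) N) _
      (q^∣-weaken (Aerr (suc e) N) (ℕP.≤-trans (ℕP.n≤1+n N) (ℕP.m≤n*m (suc N) (suc e))) (q^∣Aerr (suc e) N))
      (q^∣-⊝ _ (q^∣-weaken (Berr (suc e) N) (ℕP.≤-trans (ℕP.n≤1+n N) (ℕP.m≤n*m (suc N) (suc e ℕ.+ 2 ℕ.* N))) (q^∣Berr (suc e) N))))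
    where open SetoidReasoning ≈-setoid

-- L(-q) = A_1 and LL(q) = B_1

sumBelow-cong : ∀ {f g} M → (∀ j → f j ≈ g j) → sumBelow f M ≈ sumBelow g M
sumBelow-cong zero    f≈g = ≈-refl
sumBelow-cong (suc M) f≈g = ⊕-cong (sumBelow-cong M f≈g) (f≈g M)

sum1-as-sumBelow : ∀ (F : ℕ → Series) k m → sum1 (λ n → F n m) k ≡ sumBelow (F ∘ suc) k m
sum1-as-sumBelow F zero    m = refl
sum1-as-sumBelow F (suc k) m = cong (_+ F (suc k) m) (sum1-as-sumBelow F k m)

sumBelow-stable : ∀ f → (∀ j → q^ suc j ∣ f j) → ∀ m k → m ≤ k → sumBelow f k m ≡ sumBelow f m m
sumBelow-stable f q^∣f m k m≤k =
  subst (λ n → sumBelow f n m ≡ sumBelow f m m) (ℕP.m+[n∸m]≡n m≤k) (extend (k ∸ m))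
  where
  extend : ∀ d → sumBelow f (m ℕ.+ d) m ≡ sumBelow f m m
  extend zero    = cong (λ n → sumBelow f n m) (ℕP.+-identityʳ m)
  extend (suc d) = begin
    sumBelow f (m ℕ.+ suc d) m                   ≡⟨ cong (λ n → sumBelow f n m) (ℕP.+-suc m d) ⟩
    sumBelow f (m ℕ.+ d) m + f (m ℕ.+ d) m       ≡⟨ cong₂ _+_ (extend d) (q^∣f (m ℕ.+ d) m (s≤s (ℕP.m≤m+n m d))) ⟩
    sumBelow f m m + 0ℤ                          ≡⟨ ℤP.+-identityʳ _ ⟩
    sumBelow f m m ∎
    where open ≡-Reasoning

sumBelow-pairs : ∀ f M → sumBelow f (2 ℕ.* M) ≈ sumBelow (λ j → f (2 ℕ.* j) ⊕ f (suc (2 ℕ.* j))) M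
sumBelow-pairs f zero    = ≈-refl
sumBelow-pairs f (suc M) m = begin
  sumBelow f (2 ℕ.* suc M) m
    ≡⟨ cong (λ n → sumBelow f n m) (ℕP.*-suc 2 M) ⟩
  sumBelow f (2 ℕ.* M) m + f (2 ℕ.* M) m + f (suc (2 ℕ.* M)) m
    ≡⟨ ℤP.+-assoc (sumBelow f (2 ℕ.* M) m) (f (2 ℕ.* M) m) (f (suc (2 ℕ.* M)) m) ⟩
  sumBelow f (2 ℕ.* M) m + (f (2 ℕ.* M) m + f (suc (2 ℕ.* M)) m)
    ≡⟨ cong (_+ (f (2 ℕ.* M) m + f (suc (2 ℕ.* M)) m)) (sumBelow-pairs f M m) ⟩
  sumBelow (λ j → f (2 ℕ.* j) ⊕ f (suc (2 ℕ.* j))) (suc M) m ∎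
  where open ≡-Reasoning

negArg-sumBelow : ∀ f M → negArg (sumBelow f M) ≈ sumBelow (negArg ∘ f) M
negArg-sumBelow f zero    m = ℤP.*-zeroʳ (sgn m)
negArg-sumBelow f (suc M) m =
  trans (ℤP.*-distribˡ-+ (sgn m) (sumBelow f M m) (f M m)) (cong (_+ negArg (f M) m) (negArg-sumBelow f M m))

negArg-Lterm : ∀ n → negArg (Lterm n) ≈ aTerm 1 n
negArg-Lterm n = begin
  negArg (mono 1ℤ n ⊛ Pq 2 (n ∸ 1) ⊛ inv (Dq 2 n))
    ≈⟨ ≈-trans (negArg-⊛ (mono 1ℤ n ⊛ Pq 2 (n ∸ 1)) (inv (Dq 2 n)))
               (⊛-congˡ (negArg (inv (Dq 2 n))) (negArg-⊛ (mono 1ℤ n) (Pq 2 (n ∸ 1)))) ⟩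
  negArg (mono 1ℤ n) ⊛ negArg (Pq 2 (n ∸ 1)) ⊛ negArg (inv (Dq 2 n))
    ≈⟨ ⊛-cong (⊛-cong (≈-trans (negArg-mono 1ℤ n) (mono-cong (ℤP.*-identityʳ (sgn n)) (sym (ℕP.*-identityˡ n))))
                      (negArg-poch-even 1ℤ 1 1 (n ∸ 1)))
              (≈-trans (negArg-inv (Dq 2 n) (poch-constant (- 1ℤ) 1 2 n))
                       (inv-cong (trans (ℤP.*-identityˡ _) (poch-constant (- 1ℤ) 1 2 n)) (negArg-poch-even (- 1ℤ) 1 1 n))) ⟩
  aTerm 1 n ∎
  where open SetoidReasoning ≈-setoid

2*tri : ∀ n → 2 ℕ.* tri n ≡ n ℕ.* suc n
2*tri zero    = refl
2*tri (suc n) = begin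
  2 ℕ.* (suc n ℕ.+ tri n)            ≡⟨ ℕP.*-distribˡ-+ 2 (suc n) (tri n) ⟩
  2 ℕ.* suc n ℕ.+ 2 ℕ.* tri n        ≡⟨ cong (2 ℕ.* suc n ℕ.+_) (2*tri n) ⟩
  2 ℕ.* suc n ℕ.+ n ℕ.* suc n        ≡⟨ factor n ⟩
  suc n ℕ.* suc (suc n) ∎
  where
  open ≡-Reasoning
  factor : ∀ n → 2 ℕ.* suc n ℕ.+ n ℕ.* suc n ≡ suc n ℕ.* suc (suc n)
  factor = ℕSolver.solve-∀

tri-odd : ∀ j → tri (suc (2 ℕ.* j)) ≡ bExp 1 j
tri-odd j = ℕP.*-cancelˡ-≡ _ _ 2 (trans (2*tri (suc (2 ℕ.* j))) (identity j))
  where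
  identity : ∀ j → suc (2 ℕ.* j) ℕ.* suc (suc (2 ℕ.* j)) ≡ 2 ℕ.* ((1 ℕ.+ 2 ℕ.* j) ℕ.* suc j)
  identity = ℕSolver.solve-∀

tri-even : ∀ j → tri (suc (suc (2 ℕ.* j))) ≡ bExp 1 j ℕ.+ (2 ℕ.+ 2 ℕ.* j)
tri-even j = trans (cong (suc (suc (2 ℕ.* j)) ℕ.+_) (tri-odd j)) (ℕP.+-comm (suc (suc (2 ℕ.* j))) (bExp 1 j))

n≤tri : ∀ n → n ≤ tri n
n≤tri zero    = z≤n
n≤tri (suc n) = ℕP.m≤m+n (suc n) (tri n)

q^∣LLterm : ∀ n → q^ n ∣ LLterm n
q^∣LLterm n = q^∣-⊛ˡ _ (inv (poch (- 1ℤ) 1 1 n)) (q^∣-⊛ʳ (poch 1ℤ 1 1 (n ∸ 1)) (mono (sgn n) (tri n))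
  (q^∣-weaken (mono (sgn n) (tri n)) (n≤tri n) (q^∣mono (sgn n) (tri n))))

bTerm-LLterm : ∀ j → bTerm 1 j ≈ LLterm (suc (2 ℕ.* j)) ⊕ LLterm (suc (suc (2 ℕ.* j)))
bTerm-LLterm j = ≈-sym (begin
  LLterm (suc (2 ℕ.* j)) ⊕ LLterm (suc (suc (2 ℕ.* j)))
    ≈⟨ ⊕-cong (⊛-cong (⊛-cong (≈-sym (poch-interleave 1ℤ j)) sign-odd) inv-odd)
              (⊛-congˡ I (⊛-cong poch-odd sign-even)) ⟩
  Pq 2 j ⊛ Pq 1 j ⊛ ⊝ Z ⊛ ((one ⊕ x) ⊛ I) ⊕ Pq 2 j ⊛ Pq 1 j ⊛ (one ⊖ v) ⊛ (Z ⊛ x) ⊛ I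
    ≈⟨ solve 6 (λ a b Z x v I → a :* b :* (:- Z) :* ((con 1ℤ :+ x) :* I) :+ a :* b :* (con 1ℤ :- v) :* (Z :* x) :* I
                             := :- (Z :* a :* b :* (con 1ℤ :+ v :* x) :* I))
             (λ _ → refl) (Pq 2 j) (Pq 1 j) Z x v I ⟩
  ⊝ (Z ⊛ Pq 2 j ⊛ Pq 1 j ⊛ (one ⊕ v ⊛ x) ⊛ I)
    ≈⟨ ⊝-cong (⊛-cong (⊛-congʳ (Z ⊛ Pq 2 j ⊛ Pq 1 j) (⊕-congʳ one (≈-sym v⊛x))) (≈-sym inv-bTerm)) ⟩
  bTerm 1 j ∎)
  where
  open SetoidReasoning ≈-setoid
  Z x v I : Series
  Z = X (bExp 1 j)
  x = X (2 ℕ.+ 2 ℕ.* j)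
  v = X (1 ℕ.+ 2 ℕ.* j)
  I = inv (poch (- 1ℤ) 1 1 (suc (suc (2 ℕ.* j))))
  sign-odd : mono (sgn (suc (2 ℕ.* j))) (tri (suc (2 ℕ.* j))) ≈ ⊝ Z
  sign-odd = ≈-trans (mono-cong (cong -_ (sgn-2* j)) (tri-odd j)) (mono-neg 1ℤ (bExp 1 j))
  sign-even : mono (sgn (suc (suc (2 ℕ.* j)))) (tri (suc (suc (2 ℕ.* j)))) ≈ Z ⊛ x
  sign-even = ≈-trans (mono-cong (trans (ℤP.neg-involutive (sgn (2 ℕ.* j))) (sgn-2* j)) (tri-even j))
                      (X-split (bExp 1 j) (2 ℕ.+ 2 ℕ.* j) refl)
  poch-odd : poch 1ℤ 1 1 (suc (2 ℕ.* j)) ≈ Pq 2 j ⊛ Pq 1 j ⊛ (one ⊖ v)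
  poch-odd = ⊛-cong (≈-sym (poch-interleave 1ℤ j)) (oneMinus-cong 1ℤ (cong suc (ℕP.*-identityˡ (2 ℕ.* j))))
  inv-odd : inv (poch (- 1ℤ) 1 1 (suc (2 ℕ.* j))) ≈ (one ⊕ x) ⊛ I
  inv-odd = ≈-trans (inv-via-multiple _ (oneMinus (- 1ℤ) (1 ℕ.+ 1 ℕ.* suc (2 ℕ.* j))) _
                                      (poch-constant (- 1ℤ) 0 1 (suc (2 ℕ.* j))) refl ≈-refl)
                    (⊛-congˡ I (≈-trans (oneMinus-cong (- 1ℤ) (exponent j)) (oneMinus-neg1 (2 ℕ.+ 2 ℕ.* j))))
    where
    exponent : ∀ j → 1 ℕ.+ 1 ℕ.* suc (2 ℕ.* j) ≡ 2 ℕ.+ 2 ℕ.* j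
    exponent = ℕSolver.solve-∀
  inv-bTerm : inv (Dq 2 (suc j) ⊛ Dq 1 (suc j)) ≈ I
  inv-bTerm = inv-cong (cong₂ _*_ (poch-constant (- 1ℤ) 1 2 (suc j)) (poch-constant (- 1ℤ) 0 2 (suc j)))
    (≈-trans (poch-interleave (- 1ℤ) (suc j)) (λ m → cong (λ n → poch (- 1ℤ) 1 1 n m) (ℕP.*-suc 2 j)))
  v⊛x : X (1 ℕ.+ 4 ℕ.* j ℕ.+ 2) ≈ v ⊛ x
  v⊛x = X-split (1 ℕ.+ 2 ℕ.* j) (2 ℕ.+ 2 ℕ.* j) (exponent j)
    where
    exponent : ∀ j → 1 ℕ.+ 2 ℕ.* j ℕ.+ (2 ℕ.+ 2 ℕ.* j) ≡ 1 ℕ.+ 4 ℕ.* j ℕ.+ 2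
    exponent = ℕSolver.solve-∀

negArg-L : ∀ m → negArg L m ≡ A 1 (suc m) m
negArg-L m = begin
  sgn m * sum1 (λ n → Lterm n m) m             ≡⟨ cong (sgn m *_) (sum1-as-sumBelow Lterm m m) ⟩
  negArg (sumBelow (Lterm ∘ suc) m) m          ≡⟨ negArg-sumBelow (Lterm ∘ suc) m m ⟩
  sumBelow (negArg ∘ Lterm ∘ suc) m m          ≡⟨ sumBelow-cong m (negArg-Lterm ∘ suc) m ⟩
  A 1 m m                                      ≡⟨ sym (sumBelow-stable (aTerm 1 ∘ suc) q^∣aTerm₁ m (suc m) (ℕP.n≤1+n m)) ⟩
  A 1 (suc m) m ∎
  where
  open ≡-Reasoning
  q^∣aTerm₁ : ∀ j → q^ suc j ∣ aTerm 1 (suc j)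
  q^∣aTerm₁ j = q^∣-weaken (aTerm 1 (suc j)) (ℕP.≤-reflexive (sym (ℕP.*-identityˡ (suc j)))) (q^∣aTerm 1 (suc j))

LL≡B : ∀ m → LL m ≡ B 1 (suc m) m
LL≡B m = begin
  sum1 (λ n → LLterm n m) m                  ≡⟨ sum1-as-sumBelow LLterm m m ⟩
  sumBelow (LLterm ∘ suc) m m                ≡⟨ sym (sumBelow-stable (LLterm ∘ suc) (q^∣LLterm ∘ suc) m (2 ℕ.* suc m) m≤2[1+m]) ⟩
  sumBelow (LLterm ∘ suc) (2 ℕ.* suc m) m    ≡⟨ sumBelow-pairs (LLterm ∘ suc) (suc m) m ⟩
  sumBelow (λ j → LLterm (suc (2 ℕ.* j)) ⊕ LLterm (suc (suc (2 ℕ.* j)))) (suc m) m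
                                             ≡⟨ sumBelow-cong (suc m) (≈-sym ∘ bTerm-LLterm) m ⟩
  B 1 (suc m) m ∎
  where
  open ≡-Reasoning
  m≤2[1+m] : m ≤ 2 ℕ.* suc m
  m≤2[1+m] = ℕP.≤-trans (ℕP.n≤1+n m) (ℕP.m≤n*m (suc m) 2)

proposition5p5 : ∀ m → negArg L m ≡ LL m
proposition5p5 m = begin
  negArg L m       ≡⟨ negArg-L m ⟩
  A 1 (suc m) m    ≡⟨ ℤP.i-j≡0⇒i≡j _ _ (A≡B-mod-q^N (suc m) m (ℕP.n<1+n m)) ⟩
  B 1 (suc m) m    ≡⟨ sym (LL≡B m) ⟩
  LL m ∎
  where open ≡-Reasoning
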